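{- For every integer $d\ge 2$, $\gamma(cDB(d,1,2))=d-1$.
   Context: Let $[d]=\{1,\dots,d\}$. A sequence $(x_1,\dots,x_n)\in[d]^n$ is $t$-constrained if for all $1\le i<j\le n$ with $x_i=x_j$ one has $j-i\ge t$ (every sequence is $1$-constrained). For $1\le t\le\min\{d,n\}$, $V(d,t,n)$ denotes the set of $t$-constrained sequences in $[d]^n$. The directed $t$-constrained de Bruijn graph $cDB^+(d,t,n)$ is the subgraph of the directed de Bruijn graph on $[d]^n$ (arcs $(a_1,\dots,a_n)\to(a_2,\dots,a_n,a_{n+1})$) induced by $V(d,t,n)$; $cDB(d,t,n)$ is its undirected version, obtained by ignoring arc directions and removing loops and multiple edges. In an undirected graph a vertex dominates itself and its neighbours; a dominating set is a set $S$ of vertices such that every vertex is dominated by some vertex of $S$, and $\gamma(G)$ is the minimum size of a dominating set. -}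

module Defs where

open import Data.Nat using (ℕ; suc; _≤_; _<_; _+_; _∸_)
open import Data.Fin using (Fin; toℕ)
open import Data.Vec using (Vec; lookup; tail; _∷ʳ_)
open import Data.List using (List; length)
open import Data.List.Membership.Propositional using (_∈_)
open import Data.List.Relation.Unary.Unique.Propositional using (Unique)
open import Data.List.Relation.Unary.All using (All)
open import Data.Product using (Σ; ∃; _×_; _,_)
open import Data.Sum using (_⊎_)
open import Relation.Binary.PropositionalEquality using (_≡_; _≢_)

-- t-constrained: equal entries at positions i < j satisfy j - i ≥ t
-- (positions are 0-based here; only differences matter)
Constrained : {d n : ℕ} → ℕ → Vec (Fin d) n → Set
Constrained {d} {n} t x =
  (i j : Fin n) → toℕ i < toℕ j → lookup x i ≡ lookup x j → t ≤ toℕ j ∸ toℕ i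

V : (d t n : ℕ) → Vec (Fin d) n → Set
V d t n x = Constrained {d} {n} t x

Arc : {d n : ℕ} → Vec (Fin d) (suc n) → Vec (Fin d) (suc n) → Set
Arc {d} {n} u v = ∃ λ (a : Fin d) → tail u ∷ʳ a ≡ v

-- adjacency in the undirected graph cDB(d,t,n) (n ≥ 1): distinct vertices of
-- V(d,t,n) joined by an arc in either direction (loops / multi-edges removed)
Adj : (d t n : ℕ) → Vec (Fin d) (suc n) → Vec (Fin d) (suc n) → Set
Adj d t n u v = V d t (suc n) u × V d t (suc n) v × u ≢ v × (Arc u v ⊎ Arc v u)

Dominating : (d t n : ℕ) → List (Vec (Fin d) (suc n)) → Set
Dominating d t n S =
  All (V d t (suc n)) S ×
  ((v : Vec (Fin d) (suc n)) → V d t (suc n) v →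
     ∃ λ s → s ∈ S × (s ≡ v ⊎ Adj d t n s v))

DominationNumber : (d t n k : ℕ) → Set
DominationNumber d t n k =
  (∃ λ S → Unique S × Dominating d t n S × length S ≡ k) ×
  ((S : List (Vec (Fin d) (suc n))) → Unique S → Dominating d t n S → k ≤ length S)

-- Upper bound: for d = m + 2 and top letter ⊤ = m + 1, the d − 1 words (0,⊤) and (i,i) for
-- 0 < i < ⊤ dominate: a word (a,b) with b ≠ ⊤ has an out-neighbour (b,·) in the set, while
-- (a,⊤) is (0,⊤) itself, an out-neighbour of (0,⊤) if a = ⊤, and of (a,a) otherwise.
-- Lower bound: if every letter is the last letter of some member of a dominating set S, then
-- |S| ≥ d. Otherwise some letter a is never last; then the only in-neighbours of (a,b) are
-- missing from S, so for each of the d − 1 letters b ≠ a the word (a,b) is dominated by itself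
-- or by a word starting with b, and these dominators are pairwise distinct.
module Submission where

open import Defs
open import Data.Nat using (ℕ; suc; _≤_; _∸_; s≤s; z≤n)
open import Data.Nat.Properties using (m<n⇒0<n∸m; ≤-trans; n≤1+n)
open import Data.Fin using (Fin; zero; suc; inject₁; fromℕ; punchIn)
open import Data.Fin.Properties
  using (_≟_; all?; ¬∀⟶∃¬; injective⇒≤; inject₁-injective; punchIn-injective; punchInᵢ≢i)
open import Data.Fin.Relation.Unary.Top using (view; ‵fromℕ; ‵inject₁)
open import Data.Vec using (Vec; []; _∷_)
open import Data.Vec.Properties using (≡-dec)
open import Data.List using (List; length; tabulate; lookup)
open import Data.List.Properties using (length-tabulate)
open import Data.List.Membership.Propositional using (_∈_; find; lose)
open import Data.List.Relation.Unary.Unique.Propositional using (Unique)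
open import Data.List.Relation.Unary.Any as Any using (Any; any?)
open import Data.List.Relation.Unary.Any.Properties
  using (lookup-index; Any-⊎⁻) renaming (tabulate⁺ to Any-tabulate⁺)
open import Data.List.Relation.Unary.All using (universal)
open import Data.List.Relation.Unary.Unique.Propositional.Properties
  renaming (tabulate⁺ to Unique-tabulate⁺)
open import Data.Product using (∃; _×_; _,_)
open import Data.Sum using (_⊎_; inj₁; inj₂)
open import Relation.Nullary using (¬_; yes; no; contradiction)
open import Relation.Binary.PropositionalEquality using (_≡_; refl; sym; trans; cong; subst)

every-word-is-1-constrained : ∀ {d n} (x : Vec (Fin d) n) → V d 1 n x
every-word-is-1-constrained x i j i<j _ = m<n⇒0<n∸m i<j

distinct-witnesses⇒≤ : ∀ {A : Set} {k} (P : Fin k → A → Set) (xs : List A) →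
                       (∀ b → Any (P b) xs) → (∀ {b c x} → P b x → P c x → b ≡ c) →
                       k ≤ length xs
distinct-witnesses⇒≤ P xs witness functional = injective⇒≤ index-injective
  where
  index-injective : ∀ {b c} → Any.index (witness b) ≡ Any.index (witness c) → b ≡ c
  index-injective {b} {c} e = functional (lookup-index (witness b))
    (subst (λ i → P c (lookup xs i)) (sym e) (lookup-index (witness c)))

Word : ℕ → Set
Word d = Vec (Fin d) 2

first second : ∀ {d} → Word d → Fin d
first  (a ∷ _ ∷ []) = a
second (_ ∷ b ∷ []) = b

arc⇒second≡first : ∀ {d} (u v : Word d) → Arc u v → second u ≡ first v
arc⇒second≡first (_ ∷ _ ∷ []) _ (_ , refl) = refl

Dominates : ∀ {d} → Word d → Word d → Set
Dominates s v = s ≡ v ⊎ Arc s v ⊎ Arc v s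

covering⇒dominating : ∀ {d} (S : List (Word d)) →
                      (∀ v → Any (λ s → Dominates s v) S) → Dominating d 1 1 S
covering⇒dominating {d} S cover =
  universal every-word-is-1-constrained S , dominated
  where
  dominated : ∀ v → V d 1 2 v → ∃ λ s → s ∈ S × (s ≡ v ⊎ Adj d 1 1 s v)
  dominated v _ with find (cover v)
  ... | s , s∈S , inj₁ s≡v = s , s∈S , inj₁ s≡v
  ... | s , s∈S , inj₂ arc with ≡-dec _≟_ s v
  ...   | yes s≡v = s , s∈S , inj₁ s≡v
  ...   | no  s≢v = s , s∈S , inj₂ (every-word-is-1-constrained s ,
                                    every-word-is-1-constrained v , s≢v , arc)

dominating⇒covering : ∀ {d} {S : List (Word d)} →
                      Dominating d 1 1 S → ∀ v → Any (λ s → Dominates s v) S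
dominating⇒covering (_ , dominated) v with dominated v (every-word-is-1-constrained v)
... | s , s∈S , inj₁ s≡v               = lose s∈S (inj₁ s≡v)
... | s , s∈S , inj₂ (_ , _ , _ , arc) = lose s∈S (inj₂ arc)

every-letter-last⇒≤ : ∀ {d} (S : List (Word d)) →
                      (∀ a → Any (λ s → second s ≡ a) S) → d ≤ length S
every-letter-last⇒≤ S last =
  distinct-witnesses⇒≤ (λ a s → second s ≡ a) S last (λ p q → trans (sym p) q)

module _ (m : ℕ) where

  partner : Fin (suc m) → Fin (suc (suc m))
  partner zero    = fromℕ (suc m)
  partner (suc i) = inject₁ (suc i)

  dominator : Fin (suc m) → Word (suc (suc m))
  dominator i = inject₁ i ∷ partner i ∷ []

  dominator-injective : ∀ {i j} → dominator i ≡ dominator j → i ≡ j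
  dominator-injective e = inject₁-injective (cong first e)

  dominated-by : ∀ {v} i → Dominates (dominator i) v →
                 Any (λ s → Dominates s v) (tabulate dominator)
  dominated-by = Any-tabulate⁺

  dominators-cover : ∀ v → Any (λ s → Dominates s v) (tabulate dominator)
  dominators-cover (a ∷ b ∷ []) with view b
  ... | ‵inject₁ j = dominated-by j (inj₂ (inj₂ (partner j , refl)))
  ... | ‵fromℕ with view a
  ...   | ‵fromℕ           = dominated-by zero (inj₂ (inj₁ (fromℕ (suc m) , refl)))
  ...   | ‵inject₁ zero    = dominated-by zero (inj₁ refl)
  ...   | ‵inject₁ (suc i) = dominated-by (suc i) (inj₂ (inj₁ (fromℕ (suc m) , refl)))

  dominating-set : ∃ λ S → Unique S × Dominating (suc (suc m)) 1 1 S × length S ≡ suc m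
  dominating-set = tabulate dominator , Unique-tabulate⁺ dominator-injective ,
                   covering⇒dominating _ dominators-cover , length-tabulate dominator

  module _ (S : List (Word (suc (suc m)))) (D : Dominating (suc (suc m)) 1 1 S) where

    missing-last⇒≤ : ∀ a → ¬ Any (λ s → second s ≡ a) S → suc m ≤ length S
    missing-last⇒≤ a never-last = distinct-witnesses⇒≤ DominatesFrom S witness functional
      where
      word : Fin (suc m) → Word (suc (suc m))
      word b = a ∷ punchIn a b ∷ []

      DominatesFrom : Fin (suc m) → Word (suc (suc m)) → Set
      DominatesFrom b s = s ≡ word b ⊎ first s ≡ punchIn a b

      classify : ∀ {b s} → Dominates s (word b) → DominatesFrom b s ⊎ second s ≡ a
      classify         (inj₁ s≡v)        = inj₁ (inj₁ s≡v)
      classify {b} {s} (inj₂ (inj₁ arc)) = inj₂ (arc⇒second≡first s (word b) arc)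
      classify {b} {s} (inj₂ (inj₂ arc)) = inj₁ (inj₂ (sym (arc⇒second≡first (word b) s arc)))

      witness : ∀ b → Any (DominatesFrom b) S
      witness b with Any-⊎⁻ (Any.map classify (dominating⇒covering D (word b)))
      ... | inj₁ w = w
      ... | inj₂ w = contradiction w never-last

      functional : ∀ {b c s} → DominatesFrom b s → DominatesFrom c s → b ≡ c
      functional {b} {c} (inj₁ refl) (inj₁ e) = punchIn-injective a b c (cong second e)
      functional {b} {c} (inj₁ refl) (inj₂ e) = contradiction (sym e) (punchInᵢ≢i a c)
      functional {b} {c} (inj₂ e) (inj₁ refl) = contradiction (sym e) (punchInᵢ≢i a b)
      functional {b} {c} (inj₂ e) (inj₂ e′)   = punchIn-injective a b c (trans (sym e) e′)

    dominating-set-≥ : suc m ≤ length S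
    dominating-set-≥ with all? (λ a → any? (λ s → second s ≟ a) S)
    ... | yes last = ≤-trans (n≤1+n _) (every-letter-last⇒≤ S last)
    ... | no ¬last with ¬∀⟶∃¬ _ _ (λ a → any? (λ s → second s ≟ a) S) ¬last
    ...   | a , never-last = missing-last⇒≤ a never-last

theorem2 : (d : ℕ) → 2 ≤ d → DominationNumber d 1 1 (d ∸ 1)
theorem2 (suc (suc m)) (s≤s (s≤s z≤n)) = dominating-set m , λ S _ D → dominating-set-≥ m S D
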